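{- Let $S$ be a sorting sequence of length $p$ with $r>1$ distinct values and let $k\ge1$ be the pile size. If the sorting strategy with outcome $S$ discreetly proves that there are $f$ fake coins, then there exist general solutions for $S$ satisfying the height bound for $k$ with $f-p$ fake coins and with $f+p$ fake coins.
   Context: There are $pk$ labelled coins in $p$ piles of $k$ coins; each coin is real or fake, fake coins lighter (equal weights within each type). A sorting sequence of length $p$ is a non-decreasing sequence of $p$ non-negative integers beginning with $0$ in which each entry equals the previous one or exceeds it by $1$; it records the outcome of sorting the piles by weight (heaviest first; equal piles equal entries, a strictly lighter pile an entry one larger). If the distinct entries are $0,\dots,r-1$, let $p_i\ge1$ be the number of entries equal to $i-1$. A general solution with $f$ fake coins is an integer tuple $(f_1,\dots,f_r)$ with $0\le f_1<\dots<f_r$ and $\sum_ip_if_i=f$; it satisfies the height bound for $k$ if $f_r\le k$. The strategy discreetly proves that there are $f$ fake coins if for every coin there is a configuration consistent with the outcome with exactly $f$ fake coins in which that coin is fake and one in which it is real. -}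

module Defs where

open import Data.Nat using (ℕ; zero; suc; _+_; _*_; _∸_; _≤_; _<_)
open import Data.Nat.Properties using (_≟_)
open import Data.Fin using (Fin; toℕ) renaming (zero to fzero; suc to fsuc)
open import Data.Bool using (Bool; true; false)
open import Data.List using (List; []; _∷_; length; lookup; deduplicate; filter)
open import Data.Product using (Σ; _×_; _,_; ∃)
open import Relation.Binary.PropositionalEquality using (_≡_)

sumFin : (n : ℕ) → (Fin n → ℕ) → ℕ
sumFin zero    g = 0
sumFin (suc n) g = g fzero + sumFin n (λ i → g (fsuc i))

-- Steps a xs : xs continues a sequence whose previous entry is a,
-- each entry equal to the previous one or exceeding it by 1.
data Steps : ℕ → List ℕ → Set where
  done : ∀ {a} → Steps a []
  same : ∀ {a xs} → Steps a xs → Steps a (a ∷ xs)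
  up   : ∀ {a xs} → Steps (suc a) xs → Steps a (suc a ∷ xs)

data IsSortingSeq : List ℕ → Set where
  start : ∀ {xs} → Steps 0 xs → IsSortingSeq (0 ∷ xs)

numDistinct : List ℕ → ℕ
numDistinct S = length (deduplicate _≟_ S)

-- p_i (0-indexed: multiplicity of the value i in S, i.e. p_{i+1} in the paper)
mult : List ℕ → ℕ → ℕ
mult S i = length (filter (_≟ i) S)

-- A general solution for S with total fake coins t (indices 0-based: g i = f_{i+1}).
GeneralSolution : (S : List ℕ) → (t : ℕ) → (Fin (numDistinct S) → ℕ) → Set
GeneralSolution S t g =
  (∀ (i j : Fin (numDistinct S)) → toℕ i < toℕ j → g i < g j)
  × sumFin (numDistinct S) (λ i → mult S (toℕ i) * g i) ≡ t

HeightBound : (S : List ℕ) → (k : ℕ) → (Fin (numDistinct S) → ℕ) → Set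
HeightBound S k g = ∀ (i : Fin (numDistinct S)) → suc (toℕ i) ≡ numDistinct S → g i ≤ k

-- A configuration of p piles of k coins: true = fake.
Config : ℕ → ℕ → Set
Config p k = Fin p → Fin k → Bool

bit : Bool → ℕ
bit true  = 1
bit false = 0

fakesInPile : ∀ {p k} → Config p k → Fin p → ℕ
fakesInPile {k = k} c j = sumFin k (λ x → bit (c j x))

totalFakes : ∀ {p k} → Config p k → ℕ
totalFakes {p = p} c = sumFin p (fakesInPile c)

-- Consistency with outcome S (pile j sits at sorted position j): piles with equal
-- entries have equal weight (equal number of fakes); a larger entry means a strictly
-- lighter pile (strictly more fake coins, since fake coins are lighter).
Consistent : (S : List ℕ) → (k : ℕ) → Config (length S) k → Set
Consistent S k c =
  (∀ (i j : Fin (length S)) → lookup S i ≡ lookup S j → fakesInPile c i ≡ fakesInPile c j)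
  × (∀ (i j : Fin (length S)) → lookup S i < lookup S j → fakesInPile c i < fakesInPile c j)

DiscreetlyProves : (S : List ℕ) → (k f : ℕ) → Set
DiscreetlyProves S k f =
  ∀ (j : Fin (length S)) (x : Fin k) →
    (Σ (Config (length S) k) λ c → Consistent S k c × totalFakes c ≡ f × c j x ≡ true)
    × (Σ (Config (length S) k) λ c → Consistent S k c × totalFakes c ≡ f × c j x ≡ false)

-- Take a consistent configuration in which the first coin of a heaviest pile is fake.
-- Piles of equal value carry equally many fakes and lighter piles strictly more, so
-- every pile carries at least one fake; removing one fake from every pile leaves a
-- general solution for f − p below the height bound.  Dually, a configuration in which
-- the first coin of a lightest pile is real has at most k − 1 fakes per pile, and adding
-- one fake to every pile gives a general solution for f + p below the height bound.
module Submission where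

open import Defs
open import Data.Nat using (ℕ; zero; suc; _+_; _*_; _∸_; _≤_; _<_; z≤n; s≤s)
open import Data.Nat.Properties
open import Algebra.Properties.CommutativeMonoid.Sum +-0-commutativeMonoid
  using (sum; sum-cong-≗; ∑-distrib-+; sum-replicate-zero)
open import Data.Fin using (Fin; toℕ) renaming (zero to fzero; suc to fsuc)
open import Data.Fin.Properties using (toℕ<n)
open import Data.Bool using (Bool; true; false)
open import Data.List using (List; []; _∷_; length; lookup; deduplicate; filter)
open import Data.List.Properties using (filter-all; filter-reject)
open import Data.List.Relation.Unary.All as All using (All; []; _∷_)
open import Data.List.Relation.Unary.Any using (here; there)
open import Data.List.Membership.Propositional using (_∈_)
open import Data.List.Membership.Propositional.Properties using (∈-lookup)
open import Data.Product using (Σ; _×_; _,_; proj₁; proj₂)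
open import Data.Sum using (inj₁; inj₂)
open import Relation.Nullary using (yes; no; does; ¬_; ¬?)
open import Relation.Nullary.Negation using (contradiction)
open import Relation.Binary.PropositionalEquality
open import Function using (_∘_)

sumFin≡sum : ∀ n (g : Fin n → ℕ) → sumFin n g ≡ sum g
sumFin≡sum zero    g = refl
sumFin≡sum (suc n) g = cong (g fzero +_) (sumFin≡sum n (g ∘ fsuc))

sum-suc : ∀ {n} (g : Fin n → ℕ) → sum (λ i → suc (g i)) ≡ n + sum g
sum-suc {n} g = trans (∑-distrib-+ (λ _ → 1) g) (cong (_+ sum g) (sum-one n))
  where
  sum-one : ∀ n → sum {n} (λ _ → 1) ≡ n
  sum-one zero    = refl
  sum-one (suc n) = cong suc (sum-one n)

-- `does (m ≟ n)` reduces by recursion on m and n, so both clauses hold by computation.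
sum-bit-≟ : ∀ r (F : ℕ → ℕ) s → s < r →
            sum {r} (λ i → bit (does (s ≟ toℕ i)) * F (toℕ i)) ≡ F s
sum-bit-≟ (suc r) F zero    _         =
  trans (cong₂ _+_ (+-identityʳ (F 0)) (sum-replicate-zero r)) (+-identityʳ (F 0))
sum-bit-≟ (suc r) F (suc s) (s≤s s<r) = sum-bit-≟ r (F ∘ suc) s s<r

mult-∷ : ∀ s S v → mult (s ∷ S) v ≡ bit (does (s ≟ v)) + mult S v
mult-∷ s S v with does (s ≟ v)
... | true  = refl
... | false = refl

sum-mult : ∀ r S → All (_< r) S → (H : ℕ → ℕ) →
           sum {r} (λ i → mult S (toℕ i) * H (toℕ i)) ≡ sum (H ∘ lookup S)
sum-mult r []      _          H = sum-replicate-zero r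
sum-mult r (s ∷ S) (s<r ∷ S<r) H = begin
  sum {r} (λ i → mult (s ∷ S) (toℕ i) * H (toℕ i))
    ≡⟨ sum-cong-≗ {r} (λ i → trans (cong (_* H (toℕ i)) (mult-∷ s S (toℕ i)))
                               (*-distribʳ-+ (H (toℕ i)) (bit (does (s ≟ toℕ i))) (mult S (toℕ i)))) ⟩
  sum {r} (λ i → bit (does (s ≟ toℕ i)) * H (toℕ i) + mult S (toℕ i) * H (toℕ i))
    ≡⟨ ∑-distrib-+ {r} _ _ ⟩
  sum {r} (λ i → bit (does (s ≟ toℕ i)) * H (toℕ i)) + sum {r} (λ i → mult S (toℕ i) * H (toℕ i))
    ≡⟨ cong₂ _+_ (sum-bit-≟ r H s s<r) (sum-mult r S S<r H) ⟩
  H s + sum (H ∘ lookup S) ∎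
  where open ≡-Reasoning

sumFin-bit-≤ : ∀ k (b : Fin k → Bool) → sumFin k (bit ∘ b) ≤ k
sumFin-bit-≤ zero    b = z≤n
sumFin-bit-≤ (suc k) b with b fzero
... | true  = s≤s (sumFin-bit-≤ k (b ∘ fsuc))
... | false = m≤n⇒m≤1+n (sumFin-bit-≤ k (b ∘ fsuc))

sumFin-bit-pos : ∀ k (b : Fin k → Bool) x → b x ≡ true → 1 ≤ sumFin k (bit ∘ b)
sumFin-bit-pos (suc k) b fzero    bx rewrite bx = s≤s z≤n
sumFin-bit-pos (suc k) b (fsuc x) bx =
  ≤-trans (sumFin-bit-pos k (b ∘ fsuc) x bx) (m≤n+m _ (bit (b fzero)))

sumFin-bit-< : ∀ k (b : Fin k → Bool) x → b x ≡ false → sumFin k (bit ∘ b) < k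
sumFin-bit-< (suc k) b fzero    bx rewrite bx = s≤s (sumFin-bit-≤ k (b ∘ fsuc))
sumFin-bit-< (suc k) b (fsuc x) bx with b fzero
... | true  = s≤s (sumFin-bit-< k (b ∘ fsuc) x bx)
... | false = m≤n⇒m≤1+n (sumFin-bit-< k (b ∘ fsuc) x bx)

rises : ∀ {a xs} → Steps a xs → ℕ
rises done      = 0
rises (same st) = rises st
rises (up st)   = suc (rises st)

interval : ℕ → ℕ → List ℕ
interval a zero    = a ∷ []
interval a (suc n) = a ∷ interval (suc a) n

length-interval : ∀ a n → length (interval a n) ≡ suc n
length-interval a zero    = refl
length-interval a (suc n) = cong suc (length-interval (suc a) n)

interval-∌ : ∀ {a b} n → a < b → All (λ y → ¬ a ≡ y) (interval b n)
interval-∌ zero    a<b = (λ a≡b → <-irrefl a≡b a<b) ∷ []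
interval-∌ (suc n) a<b = (λ a≡b → <-irrefl a≡b a<b) ∷ interval-∌ n (m<n⇒m<1+n a<b)

filter-interval : ∀ a n → filter (¬? ∘ (a ≟_)) (interval (suc a) n) ≡ interval (suc a) n
filter-interval a n = filter-all (¬? ∘ (a ≟_)) (interval-∌ n ≤-refl)

∷-filter-interval : ∀ a n → a ∷ filter (¬? ∘ (a ≟_)) (interval a n) ≡ interval a n
∷-filter-interval a zero    = cong (a ∷_) (filter-reject (¬? ∘ (a ≟_)) (λ a≢a → a≢a refl))
∷-filter-interval a (suc n) = cong (a ∷_)
  (trans (filter-reject (¬? ∘ (a ≟_)) (λ a≢a → a≢a refl)) (filter-interval a n))

deduplicate-steps : ∀ {a xs} (st : Steps a xs) → deduplicate _≟_ (a ∷ xs) ≡ interval a (rises st)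
deduplicate-steps done          = refl
deduplicate-steps {a} (same st) = trans
  (cong (λ l → a ∷ filter (¬? ∘ (a ≟_)) l) (deduplicate-steps st))
  (∷-filter-interval a (rises st))
deduplicate-steps {a} (up st)   = cong (a ∷_) (trans
  (cong (filter (¬? ∘ (a ≟_))) (deduplicate-steps st))
  (filter-interval a (rises st)))

steps-≤ : ∀ {a xs} (st : Steps a xs) → All (_≤ a + rises st) (a ∷ xs)
steps-≤ {a} done  = ≤-reflexive (sym (+-identityʳ a)) ∷ []
steps-≤ (same st) with steps-≤ st
... | a≤ ∷ xs≤ = a≤ ∷ a≤ ∷ xs≤
steps-≤ {a} (up st) =
  m≤m+n a _ ∷ All.map (λ y≤ → ≤-trans y≤ (≤-reflexive (sym (+-suc a _)))) (steps-≤ st)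

steps-∈ : ∀ {a xs} (st : Steps a xs) v → a ≤ v → v ≤ a + rises st → v ∈ a ∷ xs
steps-∈ {a} done      v a≤v v≤ = here (≤-antisym (≤-trans v≤ (≤-reflexive (+-identityʳ a))) a≤v)
steps-∈ (same st)     v a≤v v≤ = there (steps-∈ st v a≤v v≤)
steps-∈ {a} (up st)   v a≤v v≤ with m≤n⇒m<n∨m≡n a≤v
... | inj₂ a≡v = here (sym a≡v)
... | inj₁ a<v = there (steps-∈ st v a<v (≤-trans v≤ (≤-reflexive (+-suc a _))))

-- The first position of v in s ∷ S; position 0 when v does not occur.
positionOf : (s : ℕ) (S : List ℕ) → ℕ → Fin (length (s ∷ S))
positionOf s []      v = fzero
positionOf s (t ∷ S) v with s ≟ v
... | yes _ = fzero
... | no  _ = fsuc (positionOf t S v)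

lookup-positionOf : ∀ s S v → v ∈ s ∷ S → lookup (s ∷ S) (positionOf s S v) ≡ v
lookup-positionOf s []      v (here v≡s) = sym v≡s
lookup-positionOf s (t ∷ S) v v∈ with s ≟ v
... | yes s≡v = s≡v
... | no  s≢v with v∈
...   | here v≡s  = contradiction (sym v≡s) s≢v
...   | there v∈S = lookup-positionOf t S v v∈S

module SortingSequence {xs : List ℕ} (st : Steps 0 xs) where

  S : List ℕ
  S = 0 ∷ xs

  top : ℕ
  top = rises st

  numDistinct≡ : numDistinct S ≡ suc top
  numDistinct≡ = trans (cong length (deduplicate-steps st)) (length-interval 0 top)

  pile : ℕ → Fin (length S)
  pile = positionOf 0 xs

  lookup-pile : ∀ {v} → v ≤ top → lookup S (pile v) ≡ v
  lookup-pile {v} v≤top = lookup-positionOf 0 xs v (steps-∈ st v z≤n v≤top)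

  lookup-≤ : ∀ j → lookup S j ≤ top
  lookup-≤ j = All.lookup (steps-≤ st) (∈-lookup j)

  toℕ-≤ : (i : Fin (numDistinct S)) → toℕ i ≤ top
  toℕ-≤ i = ≤-pred (subst (toℕ i <_) numDistinct≡ (toℕ<n i))

  increasing⇒generalSolution : ∀ {t} (H : ℕ → ℕ) →
    (∀ {v w} → v < w → w ≤ top → H v < H w) → sum (H ∘ lookup S) ≡ t →
    GeneralSolution S t (H ∘ toℕ)
  increasing⇒generalSolution H H-< sum≡t =
      (λ i j i<j → H-< i<j (toℕ-≤ j))
    , trans (sumFin≡sum r (λ i → mult S (toℕ i) * H (toℕ i))) (trans (sum-mult r S S<r H) sum≡t)
    where
    r : ℕ
    r = numDistinct S
    S<r : All (_< r) S
    S<r = All.map (λ {y} y≤ → subst (y <_) (sym numDistinct≡) (s≤s y≤)) (steps-≤ st)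

  module Profile {k} (c : Config (length S) k) (consistent : Consistent S k c) where

    profile : ℕ → ℕ
    profile v = fakesInPile c (pile v)

    profile-lookup : ∀ j → profile (lookup S j) ≡ fakesInPile c j
    profile-lookup j = proj₁ consistent _ _ (lookup-positionOf 0 xs _ (∈-lookup j))

    profile-< : ∀ {v w} → v < w → w ≤ top → profile v < profile w
    profile-< v<w w≤top = proj₂ consistent _ _
      (subst₂ _<_ (sym (lookup-pile (≤-trans (<⇒≤ v<w) w≤top))) (sym (lookup-pile w≤top)) v<w)

    profile-≤ : ∀ {v w} → v ≤ w → w ≤ top → profile v ≤ profile w
    profile-≤ v≤w w≤top with m≤n⇒m<n∨m≡n v≤w
    ... | inj₁ v<w  = <⇒≤ (profile-< v<w w≤top)
    ... | inj₂ refl = ≤-refl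

    totalFakes≡ : totalFakes c ≡ sum (profile ∘ lookup S)
    totalFakes≡ = trans (sumFin≡sum (length S) (fakesInPile c)) (sym (sum-cong-≗ profile-lookup))

  generalSolution-f∸p : ∀ {k f} x →
    (Σ (Config (length S) k) λ c → Consistent S k c × totalFakes c ≡ f × c (pile 0) x ≡ true) →
    Σ ℕ λ t → t + length S ≡ f × Σ (Fin (numDistinct S) → ℕ) λ g → GeneralSolution S t g × HeightBound S k g
  generalSolution-f∸p {k} {f} x (c , consistent , total≡f , fake) =
      sum (λ j → profile (lookup S j) ∸ 1) , t+p≡f
    , (λ i → profile (toℕ i) ∸ 1)
    , increasing⇒generalSolution (λ v → profile v ∸ 1)
        (λ v<w w≤top → ∸-monoˡ-< (profile-< v<w w≤top) (profile-pos (≤-trans (<⇒≤ v<w) w≤top))) refl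
    , λ i _ → ≤-trans (m∸n≤m _ 1) (sumFin-bit-≤ k (c (pile (toℕ i))))
    where
    open Profile c consistent
    profile-pos : ∀ {v} → v ≤ top → 1 ≤ profile v
    profile-pos v≤top = ≤-trans (sumFin-bit-pos k (c (pile 0)) x fake) (profile-≤ z≤n v≤top)
    open ≡-Reasoning
    t+p≡f : sum (λ j → profile (lookup S j) ∸ 1) + length S ≡ f
    t+p≡f = begin
      sum (λ j → profile (lookup S j) ∸ 1) + length S     ≡⟨ +-comm _ (length S) ⟩
      length S + sum (λ j → profile (lookup S j) ∸ 1)     ≡⟨ sum-suc (λ j → profile (lookup S j) ∸ 1) ⟨
      sum (λ j → suc (profile (lookup S j) ∸ 1))          ≡⟨ sum-cong-≗ (λ j → m+[n∸m]≡n (profile-pos (lookup-≤ j))) ⟩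
      sum (profile ∘ lookup S)                            ≡⟨ totalFakes≡ ⟨
      totalFakes c                                        ≡⟨ total≡f ⟩
      f                                                   ∎

  generalSolution-f+p : ∀ {k f} x →
    (Σ (Config (length S) k) λ c → Consistent S k c × totalFakes c ≡ f × c (pile top) x ≡ false) →
    Σ (Fin (numDistinct S) → ℕ) λ g → GeneralSolution S (f + length S) g × HeightBound S k g
  generalSolution-f+p {k} {f} x (c , consistent , total≡f , real) =
      (λ i → suc (profile (toℕ i)))
    , increasing⇒generalSolution (suc ∘ profile) (λ v<w w≤top → s≤s (profile-< v<w w≤top)) sum≡f+p
    , λ i _ → ≤-trans (s≤s (profile-≤ (toℕ-≤ i) ≤-refl)) (sumFin-bit-< k (c (pile top)) x real)
    where
    open Profile c consistent
    sum≡f+p : sum (suc ∘ profile ∘ lookup S) ≡ f + length S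
    sum≡f+p = trans (sum-suc (profile ∘ lookup S))
                    (trans (cong (length S +_) (trans (sym totalFakes≡) total≡f)) (+-comm (length S) f))

mainTheorem16 : (S : List ℕ) → IsSortingSeq S → 1 < numDistinct S →
                (k : ℕ) → 1 ≤ k → (f : ℕ) → DiscreetlyProves S k f →
                (Σ ℕ λ t → t + length S ≡ f ×
                   Σ (Fin (numDistinct S) → ℕ) λ g → GeneralSolution S t g × HeightBound S k g)
                × (Σ (Fin (numDistinct S) → ℕ) λ g →
                     GeneralSolution S (f + length S) g × HeightBound S k g)
mainTheorem16 _ (start st) _ (suc _) _ _ proves =
    generalSolution-f∸p fzero (proj₁ (proves (pile 0) fzero))
  , generalSolution-f+p fzero (proj₂ (proves (pile top) fzero))
  where open SortingSequence st
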